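{- For positive integers $k,n$ with $n>\max\{k,2\}$, we have $a_{k,n}=a_{k,n-1}+a_{k-1,n-2}$.
   Context: $\mathbb{N}=\{1,2,3,\dots\}$, and $\mathcal{N}$ denotes the collection of finite subsets of $\mathbb{N}$. For $E\in\mathcal{N}$ and an integer $k\ge0$, let $\omega_k(E)=\sum_{i\in E,\, i\neq k}1$ (so $\omega_0(E)=|E|$). For integers $k\ge0$, $n\ge1$, let $\mathcal{A}_{k,n}=\{E\in\mathcal{N} : E=\emptyset \text{ or } \omega_k(E)<\min E\le \max E\le n\}$ and $a_{k,n}=|\mathcal{A}_{k,n}|$. -}

module Defs where

open import Data.Bool using (Bool; true; false; _∧_; if_then_else_)
open import Data.Nat using (ℕ; zero; suc; _+_; _⊓_; _⊔_; _<ᵇ_; _≤ᵇ_; _≡ᵇ_)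
open import Data.List using (List; []; _∷_; [_]; _++_; map; foldr; length)
open import Data.Vec using (Vec; []; _∷_)

-- A finite subset E ⊆ ℕ = {1,2,3,...} with max E ≤ n is the same as a subset
-- of {1,...,n}; we encode it as a characteristic vector v : Vec Bool n, where
-- position i (0-based) records whether the number i+1 belongs to E.

allSubsets : (n : ℕ) → List (Vec Bool n)
allSubsets zero = [ [] ]
allSubsets (suc n) = map (false ∷_) (allSubsets n) ++ map (true ∷_) (allSubsets n)

elemsFrom : {n : ℕ} → ℕ → Vec Bool n → List ℕ
elemsFrom o [] = []
elemsFrom o (true ∷ v) = suc o ∷ elemsFrom (suc o) v
elemsFrom o (false ∷ v) = elemsFrom (suc o) v

elements : {n : ℕ} → Vec Bool n → List ℕ
elements = elemsFrom 0

ω : ℕ → List ℕ → ℕ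
ω k [] = 0
ω k (i ∷ E) = (if i ≡ᵇ k then 0 else 1) + ω k E

inA : ℕ → ℕ → List ℕ → Bool
inA k n [] = true
inA k n (x ∷ xs) =
  (ω k (x ∷ xs) <ᵇ foldr _⊓_ x xs) ∧ (foldr _⊓_ x xs ≤ᵇ foldr _⊔_ x xs) ∧ (foldr _⊔_ x xs ≤ᵇ n)

count : {A : Set} → (A → Bool) → List A → ℕ
count p [] = 0
count p (x ∷ xs) = (if p x then 1 else 0) + count p xs

a : ℕ → ℕ → ℕ
a k n = count (λ v → inA k n (elements v)) (allSubsets n)

{-# OPTIONS --safe #-}
-- Split 𝒜_{k,n} according to whether n ∈ E. The sets avoiding n are exactly
-- 𝒜_{k,n-1}. If n ∈ E, then n ≠ k contributes 1 to ω_k(E), so 1 ∉ E (otherwise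
-- ω_k(E) ≥ 1 = min E); hence E = (E' + 1) ∪ {n} with E' ⊆ {1,…,n-2}, and the
-- shift turns ω_k into ω_{k-1} + 1 and min into min + 1, so that
-- E ∈ 𝒜_{k,n} ⇔ E' ∈ 𝒜_{k-1,n-2}.
module Submission where

open import Defs
open import Data.Nat using (ℕ; _+_; _∸_; _⊔_; _<_; _≤_)
open import Relation.Binary.PropositionalEquality using (_≡_)
open import Data.Nat using (zero; suc; _⊓_; _<ᵇ_; _≟_; s≤s)
open import Data.Nat.Properties
open import Data.Bool using (Bool; true; false; if_then_else_)
open import Data.Bool.Properties using (T-≡; ∧-identityʳ)
open import Data.List using (List; []; _∷_; [_]; _++_; map; foldr)
open import Data.List.Relation.Unary.All as All using (All; []; _∷_)
open import Data.Vec using (Vec; []; _∷_; _∷ʳ_)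
open import Function using (_∘_; Equivalence)
open import Relation.Binary.PropositionalEquality using (_≢_; refl; cong; cong₂; sym; trans; subst; module ≡-Reasoning)
open import Relation.Nullary.Decidable using (dec-false)
open import Algebra.Properties.CommutativeSemigroup +-commutativeSemigroup using (interchange)

open ≡-Reasoning

count-++ : {A : Set} (p : A → Bool) (xs ys : List A) →
  count p (xs ++ ys) ≡ count p xs + count p ys
count-++ p [] ys = refl
count-++ p (x ∷ xs) ys rewrite count-++ p xs ys =
  sym (+-assoc (if p x then 1 else 0) (count p xs) (count p ys))

count-map : {A B : Set} (p : B → Bool) (f : A → B) (xs : List A) →
  count p (map f xs) ≡ count (p ∘ f) xs
count-map p f [] = refl
count-map p f (x ∷ xs) = cong (_ +_) (count-map p f xs)

count-cong : {A : Set} {p q : A → Bool} → (∀ x → p x ≡ q x) → (xs : List A) →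
  count p xs ≡ count q xs
count-cong p≡q [] = refl
count-cong p≡q (x ∷ xs) = cong₂ (λ b m → (if b then 1 else 0) + m) (p≡q x) (count-cong p≡q xs)

count-false : {A : Set} {p : A → Bool} → (∀ x → p x ≡ false) → (xs : List A) →
  count p xs ≡ 0
count-false p≡false [] = refl
count-false p≡false (x ∷ xs) rewrite p≡false x = count-false p≡false xs

count-allSubsets-∷ : ∀ n (p : Vec Bool (suc n) → Bool) →
  count p (allSubsets (suc n)) ≡
  count (p ∘ (false ∷_)) (allSubsets n) + count (p ∘ (true ∷_)) (allSubsets n)
count-allSubsets-∷ n p = begin
  count p (map (false ∷_) (allSubsets n) ++ map (true ∷_) (allSubsets n))
    ≡⟨ count-++ p (map (false ∷_) (allSubsets n)) (map (true ∷_) (allSubsets n)) ⟩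
  count p (map (false ∷_) (allSubsets n)) + count p (map (true ∷_) (allSubsets n))
    ≡⟨ cong₂ _+_ (count-map p _ (allSubsets n)) (count-map p _ (allSubsets n)) ⟩
  count (p ∘ (false ∷_)) (allSubsets n) + count (p ∘ (true ∷_)) (allSubsets n) ∎

count-allSubsets-∷ʳ : ∀ n (p : Vec Bool (suc n) → Bool) →
  count p (allSubsets (suc n)) ≡
  count (p ∘ (_∷ʳ false)) (allSubsets n) + count (p ∘ (_∷ʳ true)) (allSubsets n)
count-allSubsets-∷ʳ zero p = count-allSubsets-∷ zero p
count-allSubsets-∷ʳ (suc n) p = begin
  count p (allSubsets (suc (suc n)))
    ≡⟨ count-allSubsets-∷ (suc n) p ⟩
  count (p ∘ (false ∷_)) (allSubsets (suc n)) + count (p ∘ (true ∷_)) (allSubsets (suc n))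
    ≡⟨ cong₂ _+_ (count-allSubsets-∷ʳ n _) (count-allSubsets-∷ʳ n _) ⟩
  (# λ v → p (false ∷ (v ∷ʳ false))) + (# λ v → p (false ∷ (v ∷ʳ true))) +
  ((# λ v → p (true ∷ (v ∷ʳ false))) + (# λ v → p (true ∷ (v ∷ʳ true))))
    ≡⟨ interchange (# λ v → p (false ∷ (v ∷ʳ false))) (# λ v → p (false ∷ (v ∷ʳ true)))
                   (# λ v → p (true ∷ (v ∷ʳ false))) (# λ v → p (true ∷ (v ∷ʳ true))) ⟩
  (# λ v → p (false ∷ (v ∷ʳ false))) + (# λ v → p (true ∷ (v ∷ʳ false))) +
  ((# λ v → p (false ∷ (v ∷ʳ true))) + (# λ v → p (true ∷ (v ∷ʳ true))))
    ≡⟨ cong₂ _+_ (count-allSubsets-∷ n _) (count-allSubsets-∷ n _) ⟨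
  count (p ∘ (_∷ʳ false)) (allSubsets (suc n)) + count (p ∘ (_∷ʳ true)) (allSubsets (suc n)) ∎
  where
  # : (Vec Bool n → Bool) → ℕ
  # q = count q (allSubsets n)

elemsFrom->offset : ∀ {n} o (v : Vec Bool n) → All (o <_) (elemsFrom o v)
elemsFrom->offset o [] = []
elemsFrom->offset o (true ∷ v) = ≤-refl ∷ All.map <⇒≤ (elemsFrom->offset (suc o) v)
elemsFrom->offset o (false ∷ v) = All.map <⇒≤ (elemsFrom->offset (suc o) v)

elemsFrom-≤ : ∀ {n N} o (v : Vec Bool n) → o + n ≤ N → All (_≤ N) (elemsFrom o v)
elemsFrom-≤ o [] _ = []
elemsFrom-≤ {suc n} {N} o (true ∷ v) o+n≤N =
  ≤-trans (m≤m+n (suc o) n) 1+o+n≤N ∷ elemsFrom-≤ (suc o) v 1+o+n≤N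
  where
  1+o+n≤N : suc o + n ≤ N
  1+o+n≤N = subst (_≤ N) (+-suc o n) o+n≤N
elemsFrom-≤ {suc n} {N} o (false ∷ v) o+n≤N =
  elemsFrom-≤ (suc o) v (subst (_≤ N) (+-suc o n) o+n≤N)

elemsFrom-∷ʳ-false : ∀ {n} o (v : Vec Bool n) → elemsFrom o (v ∷ʳ false) ≡ elemsFrom o v
elemsFrom-∷ʳ-false o [] = refl
elemsFrom-∷ʳ-false o (true ∷ v) = cong (suc o ∷_) (elemsFrom-∷ʳ-false (suc o) v)
elemsFrom-∷ʳ-false o (false ∷ v) = elemsFrom-∷ʳ-false (suc o) v

elemsFrom-∷ʳ-true : ∀ {n} o (v : Vec Bool n) →
  elemsFrom o (v ∷ʳ true) ≡ elemsFrom o v ++ [ suc (o + n) ]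
elemsFrom-∷ʳ-true o [] = cong (λ m → [ suc m ]) (sym (+-identityʳ o))
elemsFrom-∷ʳ-true {suc n} o (true ∷ v) rewrite elemsFrom-∷ʳ-true (suc o) v | +-suc o n = refl
elemsFrom-∷ʳ-true {suc n} o (false ∷ v) rewrite elemsFrom-∷ʳ-true (suc o) v | +-suc o n = refl

elemsFrom-suc : ∀ {n} o (v : Vec Bool n) → elemsFrom (suc o) v ≡ map suc (elemsFrom o v)
elemsFrom-suc o [] = refl
elemsFrom-suc o (true ∷ v) = cong (suc (suc o) ∷_) (elemsFrom-suc (suc o) v)
elemsFrom-suc o (false ∷ v) = elemsFrom-suc (suc o) v

foldr-⊓-least : ∀ x xs → All (x ≤_) xs → foldr _⊓_ x xs ≡ x
foldr-⊓-least x [] [] = refl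
foldr-⊓-least x (y ∷ ys) (x≤y ∷ x≤ys) rewrite foldr-⊓-least x ys x≤ys = m≥n⇒m⊓n≡n x≤y

foldr-⊔-≥-init : ∀ x xs → x ≤ foldr _⊔_ x xs
foldr-⊔-≥-init x [] = ≤-refl
foldr-⊔-≥-init x (y ∷ ys) = ≤-trans (foldr-⊔-≥-init x ys) (m≤n⊔m y _)

foldr-⊔-lub : ∀ {N} x xs → All (_≤ N) (x ∷ xs) → foldr _⊔_ x xs ≤ N
foldr-⊔-lub x [] (x≤N ∷ []) = x≤N
foldr-⊔-lub x (y ∷ ys) (x≤N ∷ y≤N ∷ ys≤N) = ⊔-lub y≤N (foldr-⊔-lub x ys (x≤N ∷ ys≤N))

-- `does (m ≟ k)` unfolds to the `m ≡ᵇ k` tested by ω, so dec-false rewrites it.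
ω-++-[] : ∀ {k m} (E : List ℕ) → m ≢ k → ω k (E ++ [ m ]) ≡ suc (ω k E)
ω-++-[] {k} {m} [] m≢k rewrite dec-false (m ≟ k) m≢k = refl
ω-++-[] (i ∷ E) m≢k = trans (cong (_ +_) (ω-++-[] E m≢k)) (+-suc _ _)

ω-map-suc : ∀ k (E : List ℕ) → ω (suc k) (map suc E) ≡ ω k E
ω-map-suc k [] = refl
ω-map-suc k (i ∷ E) = cong (_ +_) (ω-map-suc k E)

ω<head : ℕ → List ℕ → Bool
ω<head k [] = true
ω<head k E@(x ∷ _) = ω k E <ᵇ x

inA-least-head : ∀ k {N x} {xs : List ℕ} → All (x ≤_) xs → All (_≤ N) (x ∷ xs) →
  inA k N (x ∷ xs) ≡ ω<head k (x ∷ xs)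
inA-least-head k {x = x} {xs} x≤xs ≤N
  rewrite foldr-⊓-least x xs x≤xs
        | Equivalence.to T-≡ (≤⇒≤ᵇ (foldr-⊔-≥-init x xs))
        | Equivalence.to T-≡ (≤⇒≤ᵇ (foldr-⊔-lub x xs ≤N)) = ∧-identityʳ _

inA-elemsFrom : ∀ k {n N} o (v : Vec Bool n) → o + n ≤ N →
  inA k N (elemsFrom o v) ≡ ω<head k (elemsFrom o v)
inA-elemsFrom k o [] _ = refl
inA-elemsFrom k {suc n} {N} o (false ∷ v) o+n≤N =
  inA-elemsFrom k (suc o) v (subst (_≤ N) (+-suc o n) o+n≤N)
inA-elemsFrom k o (true ∷ v) o+n≤N =
  inA-least-head k (All.map <⇒≤ (elemsFrom->offset (suc o) v)) (elemsFrom-≤ o (true ∷ v) o+n≤N)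

inA-elements : ∀ k {n} (v : Vec Bool n) → inA k n (elements v) ≡ ω<head k (elements v)
inA-elements k v = inA-elemsFrom k 0 v ≤-refl

ω<head-shift : ∀ k m (E : List ℕ) → suc (suc m) ≢ suc k →
  ω<head (suc k) (map suc E ++ [ suc (suc m) ]) ≡ ω<head k E
ω<head-shift k m [] 2+m≢1+k rewrite dec-false (suc (suc m) ≟ suc k) 2+m≢1+k = refl
ω<head-shift k m E@(x ∷ _) 2+m≢1+k =
  cong (_<ᵇ suc x) (trans (ω-++-[] (map suc E) 2+m≢1+k) (cong suc (ω-map-suc k E)))

inA-∷ʳ-false : ∀ k {n} (v : Vec Bool n) →
  inA k (suc n) (elements (v ∷ʳ false)) ≡ inA k n (elements v)
inA-∷ʳ-false k v = begin
  inA k _ (elements (v ∷ʳ false)) ≡⟨ inA-elements k (v ∷ʳ false) ⟩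
  ω<head k (elements (v ∷ʳ false)) ≡⟨ cong (ω<head k) (elemsFrom-∷ʳ-false 0 v) ⟩
  ω<head k (elements v)            ≡⟨ inA-elements k v ⟨
  inA k _ (elements v)             ∎

inA-false-∷-∷ʳ-true : ∀ k {n} (w : Vec Bool n) → suc (suc n) ≢ suc k →
  inA (suc k) (suc (suc n)) (elements (false ∷ (w ∷ʳ true))) ≡ inA k n (elements w)
inA-false-∷-∷ʳ-true k {n} w 2+n≢1+k = begin
  inA (suc k) _ (elements (false ∷ (w ∷ʳ true)))
    ≡⟨ inA-elements (suc k) (false ∷ (w ∷ʳ true)) ⟩
  ω<head (suc k) (elemsFrom 1 (w ∷ʳ true))
    ≡⟨ cong (ω<head (suc k)) (elemsFrom-∷ʳ-true 1 w) ⟩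
  ω<head (suc k) (elemsFrom 1 w ++ [ suc (suc n) ])
    ≡⟨ cong (λ E → ω<head (suc k) (E ++ [ suc (suc n) ])) (elemsFrom-suc 0 w) ⟩
  ω<head (suc k) (map suc (elements w) ++ [ suc (suc n) ])
    ≡⟨ ω<head-shift k n (elements w) 2+n≢1+k ⟩
  ω<head k (elements w)
    ≡⟨ inA-elements k w ⟨
  inA k n (elements w) ∎

inA-true-∷-∷ʳ-true : ∀ k {n} (w : Vec Bool n) → suc (suc n) ≢ k →
  inA k (suc (suc n)) (elements (true ∷ (w ∷ʳ true))) ≡ false
inA-true-∷-∷ʳ-true k {n} w 2+n≢k = begin
  inA k _ (elements (true ∷ (w ∷ʳ true)))
    ≡⟨ inA-elements k (true ∷ (w ∷ʳ true)) ⟩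
  ω k (1 ∷ elemsFrom 1 (w ∷ʳ true)) <ᵇ 1
    ≡⟨ cong (λ E → ω k (1 ∷ E) <ᵇ 1) (elemsFrom-∷ʳ-true 1 w) ⟩
  ω k ((1 ∷ elemsFrom 1 w) ++ [ suc (suc n) ]) <ᵇ 1
    ≡⟨ cong (_<ᵇ 1) (ω-++-[] (1 ∷ elemsFrom 1 w) 2+n≢k) ⟩
  suc (ω k (1 ∷ elemsFrom 1 w)) <ᵇ 1
    ≡⟨⟩
  false ∎

a-recurrence : ∀ k n → suc n ≢ k → a (suc k) (suc (suc n)) ≡ a (suc k) (suc n) + a k n
a-recurrence k n 1+n≢k = begin
  a (suc k) (suc (suc n))
    ≡⟨ count-allSubsets-∷ʳ (suc n) inA′ ⟩
  count (inA′ ∘ (_∷ʳ false)) (allSubsets (suc n)) + count (inA′ ∘ (_∷ʳ true)) (allSubsets (suc n))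
    ≡⟨ cong₂ _+_ (count-cong (inA-∷ʳ-false (suc k)) (allSubsets (suc n)))
                 (count-allSubsets-∷ n (inA′ ∘ (_∷ʳ true))) ⟩
  a (suc k) (suc n) +
  (count (λ w → inA′ (false ∷ (w ∷ʳ true))) (allSubsets n) +
   count (λ w → inA′ (true ∷ (w ∷ʳ true))) (allSubsets n))
    ≡⟨ cong (a (suc k) (suc n) +_) (cong₂ _+_
         (count-cong (λ w → inA-false-∷-∷ʳ-true k w 2+n≢1+k) (allSubsets n))
         (count-false (λ w → inA-true-∷-∷ʳ-true (suc k) w 2+n≢1+k) (allSubsets n))) ⟩
  a (suc k) (suc n) + (a k n + 0)
    ≡⟨ cong (a (suc k) (suc n) +_) (+-identityʳ (a k n)) ⟩
  a (suc k) (suc n) + a k n ∎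
  where
  inA′ : Vec Bool (suc (suc n)) → Bool
  inA′ v = inA (suc k) (suc (suc n)) (elements v)
  2+n≢1+k : suc (suc n) ≢ suc k
  2+n≢1+k = 1+n≢k ∘ suc-injective

proposition3p2 : (k n : ℕ) → 1 ≤ k → k ⊔ 2 < n →
    a k n ≡ a k (n ∸ 1) + a (k ∸ 1) (n ∸ 2)
proposition3p2 (suc k) (suc (suc n)) _ k⊔2<n = a-recurrence k n (>⇒≢ k<1+n)
  where
  k<1+n : k < suc n
  k<1+n = ≤-pred (≤-<-trans (m≤m⊔n (suc k) 2) k⊔2<n)
proposition3p2 (suc k) (suc zero) _ (s≤s ())
proposition3p2 (suc k) zero _ ()
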